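{- For every antimatroid $\mathcal A$, the semilattice $(\mathcal A,\cup)$ has separated equalizers.
   Context: An antimatroid is a finite family $\mathcal A$ of finite sets containing $\emptyset$, closed under union, and accessible (every nonempty $S\in\mathcal A$ has some $x\in S$ with $S\setminus\{x\}\in\mathcal A$); $(\mathcal A,\cup)$ is a semilattice with identity $\emptyset$. In a semilattice (commutative idempotent monoid, written multiplicatively), $x\mid y$ means $xz=y$ for some $z$. An equalizing pair is a pair $x,y$ with $x\mid y$ for which there exist $a,b$ with $xa\neq xb$, $xa\neq ya$, $ya=yb$, and $yb\neq xb$. A finite semilattice has separated equalizers if for each equalizing pair $x,y$ there exists $z$ with $x\mid z$, $z\mid y$, $z\neq x$, $z\neq y$. -}

module Defs where

open import Data.Nat using (ℕ)
open import Data.Fin using (Fin)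
open import Data.Fin.Subset using (Subset; ⊥; _∪_; _∈_; _-_; Nonempty)
open import Data.List using (List)
open import Data.List.Membership.Propositional renaming (_∈_ to _∈ℒ_)
open import Data.Product using (Σ; ∃; _×_; _,_)
open import Relation.Binary.PropositionalEquality using (_≡_; _≢_)

Family : ℕ → Set
Family n = List (Subset n)

record IsAntimatroid {n : ℕ} (𝒜 : Family n) : Set where
  field
    has-empty : ⊥ ∈ℒ 𝒜
    union-closed : ∀ {S T} → S ∈ℒ 𝒜 → T ∈ℒ 𝒜 → (S ∪ T) ∈ℒ 𝒜
    accessible : ∀ {S} → S ∈ℒ 𝒜 → Nonempty S →
                 Σ (Fin n) λ x → (x ∈ S) × ((S - x) ∈ℒ 𝒜)

_∣[_]_ : {n : ℕ} → Subset n → Family n → Subset n → Set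
x ∣[ 𝒜 ] y = Σ _ λ z → (z ∈ℒ 𝒜) × ((x ∪ z) ≡ y)

EqualizingPair : {n : ℕ} → Family n → Subset n → Subset n → Set
EqualizingPair 𝒜 x y =
  x ∣[ 𝒜 ] y ×
  Σ _ λ a → Σ _ λ b → (a ∈ℒ 𝒜) × (b ∈ℒ 𝒜) ×
    ((x ∪ a) ≢ (x ∪ b)) × ((x ∪ a) ≢ (y ∪ a)) ×
    ((y ∪ a) ≡ (y ∪ b)) × ((y ∪ b) ≢ (x ∪ b))

SeparatedEqualizers : {n : ℕ} → Family n → Set
SeparatedEqualizers 𝒜 =
  ∀ {x y} → x ∈ℒ 𝒜 → y ∈ℒ 𝒜 → EqualizingPair 𝒜 x y →
  Σ _ λ z → (z ∈ℒ 𝒜) × (x ∣[ 𝒜 ] z) × (z ∣[ 𝒜 ] y) × (z ≢ x) × (z ≢ y)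

module Submission where

-- An equalizing pair x ∣ y forces y ≠ x, so y ⊈ x. In an antimatroid, any feasible set not
-- contained in a feasible x can be peeled down by accessibility until it has exactly one
-- element e outside x; its union with x is the feasible cover x ∪ {e}, which lies between x
-- and y. It is distinct from y because a cover never forms an equalizing pair: if
-- (x ∪ e) ∪ a = (x ∪ e) ∪ b while neither x ∪ a nor x ∪ b contains e, then removing e from
-- both sides gives x ∪ a = x ∪ b.

open import Defs
open import Algebra using (CommutativeMonoid)
open import Data.Nat using (ℕ)
open import Data.Fin using (Fin; _≟_)
open import Data.Fin.Subset using (Subset; _∪_; _∈_; _∉_; _-_; _⊆_; _⊂_; ⁅_⁆)
open import Data.Fin.Subset.Properties
open import Data.Fin.Subset.Induction using (⊂-wellFounded)
open import Data.List.Membership.Propositional using () renaming (_∈_ to _∈ℒ_)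
open import Data.Product using (∃; _×_; _,_)
open import Data.Sum using (inj₁; inj₂)
open import Data.Empty using (⊥-elim)
open import Induction.WellFounded using (Acc; acc)
open import Relation.Nullary using (¬_; yes; no)
open import Relation.Binary.PropositionalEquality

module _ {n : ℕ} where

  open import Algebra.Properties.CommutativeSemigroup
    (CommutativeMonoid.commutativeSemigroup (∪-commutativeMonoid n))
    using (xy∙z≈xz∙y)

  ∪-lub : {p q r : Subset n} → p ⊆ r → q ⊆ r → p ∪ q ⊆ r
  ∪-lub {p} {q} p⊆r q⊆r i∈p∪q with x∈p∪q⁻ p q i∈p∪q
  ... | inj₁ i∈p = p⊆r i∈p
  ... | inj₂ i∈q = q⊆r i∈q

  p⊆q⇒p∪q≡q : {p q : Subset n} → p ⊆ q → p ∪ q ≡ q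
  p⊆q⇒p∪q≡q {p} {q} p⊆q = ⊆-antisym (∪-lub p⊆q ⊆-refl) (q⊆p∪q p q)

  x∈p⇒⁅x⁆⊆p : {p : Subset n} {x : Fin n} → x ∈ p → ⁅ x ⁆ ⊆ p
  x∈p⇒⁅x⁆⊆p {x = x} x∈p i∈⁅x⁆ rewrite x∈⁅y⁆⇒x≡y x i∈⁅x⁆ = x∈p

  x∈p⇒p∪⁅x⁆≡p : {p : Subset n} {x : Fin n} → x ∈ p → p ∪ ⁅ x ⁆ ≡ p
  x∈p⇒p∪⁅x⁆≡p x∈p = ⊆-antisym (∪-lub ⊆-refl (x∈p⇒⁅x⁆⊆p x∈p)) (p⊆p∪q _)

  x∉p⇒p∪⁅x⁆≢p : {p : Subset n} {x : Fin n} → x ∉ p → p ∪ ⁅ x ⁆ ≢ p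
  x∉p⇒p∪⁅x⁆≢p {p} {x} x∉p eq = x∉p (subst (x ∈_) eq (q⊆p∪q p ⁅ x ⁆ (x∈⁅x⁆ x)))

  p-x⊆q⇒p⊆q∪⁅x⁆ : {p q : Subset n} {x : Fin n} → p - x ⊆ q → p ⊆ q ∪ ⁅ x ⁆
  p-x⊆q⇒p⊆q∪⁅x⁆ {x = x} p-x⊆q {i} i∈p with i ≟ x
  ... | yes refl = x∈p∪q⁺ (inj₂ (x∈⁅x⁆ x))
  ... | no  i≢x  = x∈p∪q⁺ (inj₁ (p-x⊆q (x∈p∧x≢y⇒x∈p-y i∈p i≢x)))

  ∪⁅x⁆-cancel-⊆ : {p q : Subset n} {x : Fin n} → x ∉ p → p ∪ ⁅ x ⁆ ⊆ q ∪ ⁅ x ⁆ → p ⊆ q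
  ∪⁅x⁆-cancel-⊆ {p} {q} {x} x∉p p∪x⊆q∪x {i} i∈p
    with x∈p∪q⁻ q ⁅ x ⁆ (p∪x⊆q∪x (p⊆p∪q ⁅ x ⁆ i∈p))
  ... | inj₁ i∈q   = i∈q
  ... | inj₂ i∈⁅x⁆ rewrite x∈⁅y⁆⇒x≡y x i∈⁅x⁆ = ⊥-elim (x∉p i∈p)

  ∪⁅x⁆-cancel : {p q : Subset n} {x : Fin n} → x ∉ p → x ∉ q → p ∪ ⁅ x ⁆ ≡ q ∪ ⁅ x ⁆ → p ≡ q
  ∪⁅x⁆-cancel x∉p x∉q eq =
    ⊆-antisym (∪⁅x⁆-cancel-⊆ x∉p (⊆-reflexive eq)) (∪⁅x⁆-cancel-⊆ x∉q (⊆-reflexive (sym eq)))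

  ∣⇒⊆ : {𝒜 : Family n} {x y : Subset n} → x ∣[ 𝒜 ] y → x ⊆ y
  ∣⇒⊆ {x = x} (z , _ , refl) = p⊆p∪q z

  ⊆⇒∣ : {𝒜 : Family n} {x y : Subset n} → y ∈ℒ 𝒜 → x ⊆ y → x ∣[ 𝒜 ] y
  ⊆⇒∣ {y = y} y∈𝒜 x⊆y = y , y∈𝒜 , p⊆q⇒p∪q≡q x⊆y

  equalizingPair⇒⊈ : {𝒜 : Family n} {x y : Subset n} → EqualizingPair 𝒜 x y → ¬ y ⊆ x
  equalizingPair⇒⊈ (x∣y , _ , _ , _ , _ , _ , xa≢ya , _ , _) y⊆x
    with ⊆-antisym (∣⇒⊆ x∣y) y⊆x
  ... | refl = xa≢ya refl

  equalizingPair⇒≢cover : {𝒜 : Family n} {x y : Subset n} {e : Fin n} →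
                          EqualizingPair 𝒜 x y → x ∪ ⁅ e ⁆ ≢ y
  equalizingPair⇒≢cover {x = x} {e = e} (_ , a , b , _ , _ , xa≢xb , xa≢ya , ya≡yb , yb≢xb) refl =
    xa≢xb (∪⁅x⁆-cancel (e∉ xa≢ya) (e∉ (≢-sym yb≢xb)) xa∪e≡xb∪e)
    where
    e∉ : {c : Subset n} → x ∪ c ≢ (x ∪ ⁅ e ⁆) ∪ c → e ∉ x ∪ c
    e∉ {c} xc≢yc e∈xc = xc≢yc (sym (trans (xy∙z≈xz∙y x ⁅ e ⁆ c) (x∈p⇒p∪⁅x⁆≡p e∈xc)))

    xa∪e≡xb∪e : (x ∪ a) ∪ ⁅ e ⁆ ≡ (x ∪ b) ∪ ⁅ e ⁆
    xa∪e≡xb∪e = begin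
      (x ∪ a) ∪ ⁅ e ⁆ ≡⟨ xy∙z≈xz∙y x a ⁅ e ⁆ ⟩
      (x ∪ ⁅ e ⁆) ∪ a ≡⟨ ya≡yb ⟩
      (x ∪ ⁅ e ⁆) ∪ b ≡⟨ xy∙z≈xz∙y x ⁅ e ⁆ b ⟩
      (x ∪ b) ∪ ⁅ e ⁆ ∎
      where open ≡-Reasoning

  module _ {𝒜 : Family n} (antimatroid : IsAntimatroid 𝒜) where
    open IsAntimatroid antimatroid

    augmentation : {x S : Subset n} → x ∈ℒ 𝒜 → S ∈ℒ 𝒜 → ¬ S ⊆ x →
                   ∃ λ e → e ∈ S × e ∉ x × (x ∪ ⁅ e ⁆) ∈ℒ 𝒜
    augmentation {x} {S} x∈𝒜 S∈𝒜 S⊈x = go S∈𝒜 S⊈x (⊂-wellFounded S)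
      where
      go : {S : Subset n} → S ∈ℒ 𝒜 → ¬ S ⊆ x → Acc _⊂_ S →
           ∃ λ e → e ∈ S × e ∉ x × (x ∪ ⁅ e ⁆) ∈ℒ 𝒜
      go {S} S∈𝒜 S⊈x (acc smaller) with nonempty? S
      ... | no S-empty = ⊥-elim (S⊈x (λ i∈S → ⊥-elim (S-empty (_ , i∈S))))
      ... | yes S-nonempty with accessible S∈𝒜 S-nonempty
      ...   | e , e∈S , S-e∈𝒜 with (S - e) ⊆? x
      ...     | no S-e⊈x =
        let e′ , e′∈S-e , e′∉x , x∪e′∈𝒜 = go S-e∈𝒜 S-e⊈x (smaller (x∈p⇒p-x⊂p e∈S))
        in e′ , p─q⊆p S ⁅ e ⁆ e′∈S-e , e′∉x , x∪e′∈𝒜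
      ...     | yes S-e⊆x = e , e∈S , e∉x , subst (_∈ℒ 𝒜) x∪S≡x∪e (union-closed x∈𝒜 S∈𝒜)
        where
        S⊆x∪e : S ⊆ x ∪ ⁅ e ⁆
        S⊆x∪e = p-x⊆q⇒p⊆q∪⁅x⁆ S-e⊆x

        e∉x : e ∉ x
        e∉x e∈x = S⊈x (subst (S ⊆_) (x∈p⇒p∪⁅x⁆≡p e∈x) S⊆x∪e)

        x∪S≡x∪e : x ∪ S ≡ x ∪ ⁅ e ⁆
        x∪S≡x∪e = ⊆-antisym (∪-lub (p⊆p∪q ⁅ e ⁆) S⊆x∪e)
                            (∪-lub (p⊆p∪q S) (⊆-trans (x∈p⇒⁅x⁆⊆p e∈S) (q⊆p∪q x S)))

mainTheorem11 : (n : ℕ) (𝒜 : Family n) → IsAntimatroid 𝒜 → SeparatedEqualizers 𝒜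
mainTheorem11 n 𝒜 antimatroid {x} {y} x∈𝒜 y∈𝒜 equalizing@(x∣y , _)
  with augmentation antimatroid x∈𝒜 y∈𝒜 (equalizingPair⇒⊈ equalizing)
... | e , e∈y , e∉x , x∪e∈𝒜 =
  x ∪ ⁅ e ⁆ , x∪e∈𝒜 ,
  ⊆⇒∣ x∪e∈𝒜 (p⊆p∪q ⁅ e ⁆) ,
  ⊆⇒∣ y∈𝒜 (∪-lub (∣⇒⊆ x∣y) (x∈p⇒⁅x⁆⊆p e∈y)) ,
  x∉p⇒p∪⁅x⁆≢p e∉x ,
  equalizingPair⇒≢cover equalizing
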